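{- Let $P$ be a program and let $B$ be a set of pattern rules that is correct w.r.t. $P$. Then $\mathit{patunf}(P,B)$ is correct w.r.t. $P$.
   Context: Fix a signature $\Sigma$, a special constant $\mathsf{e}$ (also denoting the empty sequence) and an infinite countable set $X$ of variables, pairwise disjoint. $T(\Sigma,X)$ is the set of terms, $S(\Sigma,X)$ the set of substitutions (maps $X\to T(\Sigma,X)$ moving finitely many variables); composition $x(\sigma\theta)=(x\sigma)\theta$; $\emptyset$ is the identity substitution, $\sigma^0=\emptyset$, $\sigma^{n+1}=\sigma^n\sigma$; $\mathsf{e}\theta=\mathsf{e}$. $\sigma$ commutes with $\theta$ if $x\sigma\theta=x\theta\sigma$ for all $x\in X$. A renaming is a substitution that is a bijection on $X$; $\mathit{mgu}$ is the set of most general unifiers (componentwise on finite sequences). $\mathit{Var}(\sigma)$ is the set of variables in the domain or in the images of the domain. A program is a set of rules $(u,\bar v)$ ($u$ a term, $\bar v$ a finite sequence of terms written $\langle\dots\rangle$); binary rules have $\bar v$ of length $\le1$, written $(u,v)$ with $v\in T(\Sigma,X)\cup\{\mathsf{e}\}$. $[r]$ is the set of renamings of a rule $r$, $[U]=\bigcup_{r\in U}[r]$; $\bar r\ll_S U$ means $\bar r$ is a sequence of elements of $U$ variable disjoint from $S$ and from each other. Let $\mathit{id}$ be the set of rules $(\mathsf{f}(x_1,\dots,x_m),\mathsf{f}(x_1,\dots,x_m))$, $\mathsf{f}\in\Sigma$ of arity $m$, $x_i$ distinct variables. For a set $U$ of binary rules, $T_P^\beta(U)=[\{(u,\mathsf{e})\in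 P\}]\cup[\{(u\theta,v\theta)\mid r=(u,\langle v_1,\dots,v_m\rangle)\in P,\ 1\le i\le m,\ \langle(u_1,\mathsf{e}),\dots,(u_{i-1},\mathsf{e}),(u_i,v)\rangle\ll_r U\cup\mathit{id},\ v\neq\mathsf{e}\text{ if }i<m,\ \theta\in\mathit{mgu}(\langle u_1,\dots,u_i\rangle,\langle v_1,\dots,v_i\rangle)\}]$; $\mathit{binunf}(P)=\bigcup_{n\in\mathbb N}(T_P^\beta)^n(\emptyset)$. A pattern substitution is a pair $(\sigma,\mu)$ of substitutions, with $(\sigma,\mu)(n)=\sigma^n\mu$. A pattern term is $p=(s,(\sigma,\mu))$ with $s\in T(\Sigma,X)\cup\{\mathsf{e}\}$, $p(n)=s\sigma^n\mu$, $\mathit{Var}(p)=\mathit{Var}(s)\cup\mathit{Var}(\sigma)\cup\mathit{Var}(\mu)$; $\widehat{s}=(s,(\emptyset,\emptyset))$. A pattern rule is a pair $r=(p,q)$ of pattern terms, $\mathit{Var}(r)=\mathit{Var}(p)\cup\mathit{Var}(q)$, $\mathit{rules}(r)=\{(p(n),q(n))\mid n\in\mathbb N\}$; it is correct w.r.t. $P$ if $\mathit{rules}(r)\subseteq\mathit{binunf}(P)$, and a set of pattern rules is correct if all its elements are. A pattern substitution $\theta$ is an mgu of two equal-length sequences of pattern terms $\langle p_1,\dots,p_i\rangle,\langle q_1,\dots,q_i\rangle$ if for all $n$, $\theta(n)\in\mathit{mgu}(\langle p_1(n),\dots\rangle,\langle q_1(n),\dots\rangle)$. For a pattern rule $r$,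 $[r]=\{r'\text{ pattern rule}\mid \mathit{rules}(r')\subseteq[\mathit{rules}(r)]\}$ and $[U]=\bigcup_{r\in U}[r]$; $\ll_r$ is extended to pattern rules using the variable sets above. $\mathit{patid}$ is the set of pattern rules $(\widehat{\mathsf{f}(x_1,\dots,x_m)},\widehat{\mathsf{f}(x_1,\dots,x_m)})$, $\mathsf{f}\in\Sigma$ of arity $m$, distinct $x_i$. For sets $B,U$ of pattern rules, $T^\pi_{P,B}(U)=[B]\cup[\{((u,(\sigma,\mu)),(v,(\sigma_i\sigma,\mu_i\mu)))\mid r=(u,\langle v_1,\dots,v_m\rangle)\in P,\ 1\le i\le m,\ \langle(p_1,\widehat{\mathsf{e}}),\dots,(p_{i-1},\widehat{\mathsf{e}}),(p_i,(v,(\sigma_i,\mu_i)))\rangle\ll_r U\cup\mathit{patid},\ v\neq\mathsf{e}\text{ if }i<m,\ (\sigma,\mu)\text{ an mgu of }\langle p_1,\dots,p_i\rangle\text{ and }\langle\widehat{v_1},\dots,\widehat{v_i}\rangle,\ \sigma\text{ commutes with }\sigma_i\text{ and }\mu_i\}]$. The pattern unfolding is $\mathit{patunf}(P,B)=\bigcup_{n\in\mathbb N}(T^\pi_{P,B})^n(\emptyset)$. -}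

module Defs where

open import Data.Nat using (ℕ; zero; suc; _≤_; _⊔_)
open import Data.Nat.Properties using (m⊔n≤o⇒m≤o; m⊔n≤o⇒n≤o)
open import Data.Fin using (Fin)
open import Data.Vec using (Vec; []; _∷_; _∷ʳ_; lookup; toList)
import Data.Vec as Vec
open import Data.List using (List; []; _∷_; _++_)
open import Data.Product using (Σ; _×_; _,_; proj₁; proj₂)
open import Data.Sum using (_⊎_)
open import Data.Empty using (⊥)
open import Relation.Nullary using (¬_)
open import Relation.Binary.PropositionalEquality using (_≡_; _≢_; refl; trans)

-- A signature: function symbols with arities.  Variables X = ℕ.
-- The special constant e is not a symbol of Σ (it is the constructor
-- `e` of TermE below), so Σ, {e} and X are pairwise disjoint.

record Signature : Set₁ where
  field
    Sym   : Set
    arity : Sym → ℕ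

module _ (Sig : Signature) where
  open Signature Sig

  data Term : Set where
    var : ℕ → Term
    fun : (f : Sym) → Vec Term (arity f) → Term

  data TermE : Set where
    e  : TermE
    tm : Term → TermE

module _ {Sig : Signature} where
  open Signature Sig

  mutual
    Occ : ℕ → Term Sig → Set
    Occ x (var y)    = x ≡ y
    Occ x (fun f ts) = OccV x ts

    OccV : ∀ {n} → ℕ → Vec (Term Sig) n → Set
    OccV x []       = ⊥
    OccV x (t ∷ ts) = Occ x t ⊎ OccV x ts

  OccE : ℕ → TermE Sig → Set
  OccE x e      = ⊥
  OccE x (tm t) = Occ x t

  record Subst : Set where
    field
      app   : ℕ → Term Sig
      bound : ℕ
      fin   : ∀ x → bound ≤ x → app x ≡ var x
  open Subst public

  mutual
    sub : Term Sig → Subst → Term Sig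
    sub (var x)    σ = app σ x
    sub (fun f ts) σ = fun f (subV ts σ)

    subV : ∀ {n} → Vec (Term Sig) n → Subst → Vec (Term Sig) n
    subV []       σ = []
    subV (t ∷ ts) σ = sub t σ ∷ subV ts σ

  subE : TermE Sig → Subst → TermE Sig
  subE e      σ = e
  subE (tm t) σ = tm (sub t σ)

  idS : Subst
  idS = record { app = var ; bound = 0 ; fin = λ x _ → refl }

  _⊙_ : Subst → Subst → Subst
  σ ⊙ θ = record
    { app   = λ x → sub (app σ x) θ
    ; bound = bound σ ⊔ bound θ
    ; fin   = λ x b≤x → prf x b≤x }
    where
    prf : ∀ x → bound σ ⊔ bound θ ≤ x → sub (app σ x) θ ≡ var x
    prf x b≤x with app σ x | fin σ x (m⊔n≤o⇒m≤o (bound σ) (bound θ) b≤x)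
    ... | .(var x) | refl = fin θ x (m⊔n≤o⇒n≤o (bound σ) (bound θ) b≤x)

  pow : Subst → ℕ → Subst
  pow σ zero    = idS
  pow σ (suc n) = pow σ n ⊙ σ

  _≈ₛ_ : Subst → Subst → Set
  σ ≈ₛ θ = ∀ x → app σ x ≡ app θ x

  Commutes : Subst → Subst → Set
  Commutes σ θ = ∀ x → sub (app σ x) θ ≡ sub (app θ x) σ

  IsRenaming : Subst → Set
  IsRenaming σ = Σ (ℕ → ℕ) λ ρ →
    (∀ x → app σ x ≡ var (ρ x)) ×
    (∀ x y → ρ x ≡ ρ y → x ≡ y) ×
    (∀ y → Σ ℕ λ x → ρ x ≡ y)

  VarS : Subst → ℕ → Set
  VarS σ x = (app σ x ≢ var x) ⊎ Σ ℕ λ y → (app σ y ≢ var y) × Occ x (app σ y)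

  Unifies : ∀ {n} → Subst → Vec (TermE Sig) n → Vec (TermE Sig) n → Set
  Unifies θ ss ts = Vec.map (λ s → subE s θ) ss ≡ Vec.map (λ t → subE t θ) ts

  IsMGU : ∀ {n} → Subst → Vec (TermE Sig) n → Vec (TermE Sig) n → Set
  IsMGU θ ss ts = Unifies θ ss ts ×
    (∀ η → Unifies η ss ts → Σ Subst λ δ → ∀ x → app η x ≡ sub (app θ x) δ)

  Seq≪ : ∀ {R : Set} → (R → ℕ → Set) → (ℕ → Set) → (R → Set) →
         ∀ {n} → Vec R n → Set
  Seq≪ VarR S U rs =
    (∀ j → U (lookup rs j)) ×
    (∀ j x → VarR (lookup rs j) x → ¬ S x) ×
    (∀ j j' → j ≢ j' → ∀ x → VarR (lookup rs j) x → ¬ VarR (lookup rs j') x)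

  Distinct : ∀ {n} → Vec ℕ n → Set
  Distinct {n} xs = ∀ (i j : Fin n) → lookup xs i ≡ lookup xs j → i ≡ j

  ProgRule : Set
  ProgRule = Term Sig × List (Term Sig)

  Program : Set₁
  Program = ProgRule → Set

  VarProg : ProgRule → ℕ → Set
  VarProg (u , vs) x = Occ x u ⊎ OccV x (Vec.fromList vs)

  BinRule : Set
  BinRule = Term Sig × TermE Sig

  VarB : BinRule → ℕ → Set
  VarB (u , v) x = Occ x u ⊎ OccE x v

  renB : BinRule → Subst → BinRule
  renB (u , v) ρ = (sub u ρ , subE v ρ)

  RenB : (BinRule → Set) → BinRule → Set
  RenB U b = Σ BinRule λ r → U r × Σ Subst λ ρ → IsRenaming ρ × b ≡ renB r ρ

  IdRule : BinRule → Set
  IdRule b = Σ Sym λ f → Σ (Vec ℕ (arity f)) λ xs → Distinct xs ×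
    b ≡ (fun f (Vec.map var xs) , tm (fun f (Vec.map var xs)))

  BaseB : Program → BinRule → Set
  BaseB P b = Σ (Term Sig) λ u → P (u , []) × b ≡ (u , e)

  -- the second part of T_P^β(U).  The body of r is split as
  -- pre ++ vi ∷ post with |pre| = k, so i = k + 1 and  i < m  iff post ≠ [].
  record StepB (P : Program) (U : BinRule → Set) (b : BinRule) : Set where
    field
      u    : Term Sig
      vs   : List (Term Sig)
      inP  : P (u , vs)
      k    : ℕ
      pre  : Vec (Term Sig) k
      vi   : Term Sig
      post : List (Term Sig)
      split : vs ≡ toList pre ++ (vi ∷ post)
      us   : Vec (Term Sig) k
      ui   : Term Sig
      v    : TermE Sig
      seq  : Seq≪ VarB (VarProg (u , vs)) (λ r → U r ⊎ IdRule r)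
                  (Vec.map (λ w → (w , e)) us ∷ʳ (ui , v))
      nonE : post ≢ [] → v ≢ e
      θ    : Subst
      mgu  : IsMGU θ (Vec.map tm (us ∷ʳ ui)) (Vec.map tm (pre ∷ʳ vi))
      res  : b ≡ (sub u θ , subE v θ)

  Tβ : Program → (BinRule → Set) → BinRule → Set
  Tβ P U b = RenB (BaseB P) b ⊎ RenB (StepB P U) b

  Tβ^ : Program → ℕ → BinRule → Set
  Tβ^ P zero    b = ⊥
  Tβ^ P (suc n) b = Tβ P (Tβ^ P n) b

  binunf : Program → BinRule → Set
  binunf P b = Σ ℕ λ n → Tβ^ P n b

  PatSubst : Set
  PatSubst = Subst × Subst

  atP : PatSubst → ℕ → Subst
  atP (σ , μ) n = pow σ n ⊙ μ

  PatTerm : Set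
  PatTerm = TermE Sig × PatSubst

  evalP : PatTerm → ℕ → TermE Sig
  evalP (s , θ) n = subE s (atP θ n)

  VarPT : PatTerm → ℕ → Set
  VarPT (s , (σ , μ)) x = OccE x s ⊎ VarS σ x ⊎ VarS μ x

  hat : TermE Sig → PatTerm
  hat s = (s , (idS , idS))

  PatRule : Set
  PatRule = PatTerm × PatTerm

  VarPR : PatRule → ℕ → Set
  VarPR (p , q) x = VarPT p x ⊎ VarPT q x

  ruleAt : PatRule → ℕ → TermE Sig × TermE Sig
  ruleAt (p , q) n = (evalP p n , evalP q n)

  embB : BinRule → TermE Sig × TermE Sig
  embB (u , v) = (tm u , v)

  CorrectRule : Program → PatRule → Set
  CorrectRule P r = ∀ n → Σ BinRule λ b → binunf P b × embB b ≡ ruleAt r n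

  Correct : Program → (PatRule → Set) → Set
  Correct P B = ∀ r → B r → CorrectRule P r

  _≈ₚ_ : PatTerm → PatTerm → Set
  (s , (σ , μ)) ≈ₚ (s' , (σ' , μ')) = (s ≡ s') × (σ ≈ₛ σ') × (μ ≈ₛ μ')

  renPair : TermE Sig × TermE Sig → Subst → TermE Sig × TermE Sig
  renPair (a , b) ρ = (subE a ρ , subE b ρ)

  InRen : PatRule → PatRule → Set
  InRen r r' = ∀ n → Σ ℕ λ m → Σ Subst λ ρ → IsRenaming ρ ×
    ruleAt r' n ≡ renPair (ruleAt r m) ρ

  RenP : (PatRule → Set) → PatRule → Set
  RenP U r' = Σ PatRule λ r → U r × InRen r r'

  PatId : PatRule → Set
  PatId (p , q) = Σ Sym λ f → Σ (Vec ℕ (arity f)) λ xs → Distinct xs ×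
    (p ≈ₚ hat (tm (fun f (Vec.map var xs)))) ×
    (q ≈ₚ hat (tm (fun f (Vec.map var xs))))

  IsPatMGU : ∀ {n} → PatSubst → Vec PatTerm n → Vec PatTerm n → Set
  IsPatMGU θ ps qs = ∀ n →
    IsMGU (atP θ n) (Vec.map (λ p → evalP p n) ps) (Vec.map (λ q → evalP q n) qs)

  record StepP (P : Program) (U : PatRule → Set) (r' : PatRule) : Set where
    field
      u    : Term Sig
      vs   : List (Term Sig)
      inP  : P (u , vs)
      k    : ℕ
      pre  : Vec (Term Sig) k
      vi   : Term Sig
      post : List (Term Sig)
      split : vs ≡ toList pre ++ (vi ∷ post)
      ps   : Vec PatTerm k
      pᵢ   : PatTerm
      v    : TermE Sig
      σᵢ   : Subst
      μᵢ   : Subst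
      seq  : Seq≪ VarPR (VarProg (u , vs)) (λ r → U r ⊎ PatId r)
                  (Vec.map (λ p → (p , hat e)) ps ∷ʳ (pᵢ , (v , (σᵢ , μᵢ))))
      nonE : post ≢ [] → v ≢ e
      σ    : Subst
      μ    : Subst
      mgu  : IsPatMGU (σ , μ) (ps ∷ʳ pᵢ) (Vec.map (λ w → hat (tm w)) (pre ∷ʳ vi))
      commσ : Commutes σ σᵢ
      commμ : Commutes σ μᵢ
      res  : r' ≡ ((tm u , (σ , μ)) , (v , (σᵢ ⊙ σ , μᵢ ⊙ μ)))

  Tπ : Program → (PatRule → Set) → (PatRule → Set) → PatRule → Set
  Tπ P B U r = RenP B r ⊎ RenP (StepP P U) r

  Tπ^ : Program → (PatRule → Set) → ℕ → PatRule → Set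
  Tπ^ P B zero    r = ⊥
  Tπ^ P B (suc n) r = Tπ P B (Tπ^ P B n) r

  patunf : Program → (PatRule → Set) → PatRule → Set
  patunf P B r = Σ ℕ λ n → Tπ^ P B n r

-- Renamings preserve
-- correctness, so only a pattern step of T^π needs an argument.  Evaluated at
-- n, such a step is an ordinary step of T_P^β: its body rules instantiate to
-- binary unfoldings (all present at a common stage) or identity rules, the
-- n-th instance of the pattern mgu is an mgu of the instantiated bodies, and
-- the commutation hypotheses give  (σᵢⁿ μᵢ)(σⁿ μ) = (σᵢ σ)ⁿ (μᵢ μ),  so the
-- binary rule obtained is the n-th instance of the new pattern rule.
module Submission where

open import Defs
open import Data.Nat using (ℕ; zero; suc; _≤_; _⊔_; _≟_; z≤n; s≤s)
open import Data.Nat.Properties using (m≤m⊔n; m≤n⊔m)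
open import Data.Fin using (zero; suc)
open import Data.Vec using (Vec; []; _∷_; _∷ʳ_; lookup)
import Data.Vec as Vec
import Data.Vec.Properties as VecP
open import Data.Product using (Σ; _×_; _,_; proj₁; proj₂)
open import Data.Sum using (_⊎_; inj₁; inj₂; [_,_])
import Data.Sum as Sum
open import Function using (_∘_)
open import Relation.Nullary using (Dec; yes; no)
import Relation.Nullary.Decidable as Dec
open import Relation.Unary using (_⊆_)
open import Relation.Binary.PropositionalEquality using (_≡_; refl; sym; trans; cong; cong₂; subst; subst₂; module ≡-Reasoning)

module _ {Sig : Signature} where

  private
    T : Set
    T = Term Sig

  mutual
    sub-⊙ : ∀ t (σ θ : Subst) → sub t (σ ⊙ θ) ≡ sub (sub t σ) θ
    sub-⊙ (var x)    σ θ = refl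
    sub-⊙ (fun f ts) σ θ = cong (fun f) (subV-⊙ ts σ θ)

    subV-⊙ : ∀ {n} (ts : Vec T n) (σ θ : Subst) → subV ts (σ ⊙ θ) ≡ subV (subV ts σ) θ
    subV-⊙ []       σ θ = refl
    subV-⊙ (t ∷ ts) σ θ = cong₂ _∷_ (sub-⊙ t σ θ) (subV-⊙ ts σ θ)

  mutual
    sub-cong : ∀ t {σ θ : Subst} → σ ≈ₛ θ → sub t σ ≡ sub t θ
    sub-cong (var x)    σ≈θ = σ≈θ x
    sub-cong (fun f ts) σ≈θ = cong (fun f) (subV-cong ts σ≈θ)

    subV-cong : ∀ {n} (ts : Vec T n) {σ θ : Subst} → σ ≈ₛ θ → subV ts σ ≡ subV ts θ
    subV-cong []       σ≈θ = refl
    subV-cong (t ∷ ts) σ≈θ = cong₂ _∷_ (sub-cong t σ≈θ) (subV-cong ts σ≈θ)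

  mutual
    sub-≈idS : ∀ t {σ : Subst} → σ ≈ₛ idS → sub t σ ≡ t
    sub-≈idS (var x)    σ≈id = σ≈id x
    sub-≈idS (fun f ts) σ≈id = cong (fun f) (subV-≈idS ts σ≈id)

    subV-≈idS : ∀ {n} (ts : Vec T n) {σ : Subst} → σ ≈ₛ idS → subV ts σ ≡ ts
    subV-≈idS []       σ≈id = refl
    subV-≈idS (t ∷ ts) σ≈id = cong₂ _∷_ (sub-≈idS t σ≈id) (subV-≈idS ts σ≈id)

  sub-idS : ∀ t → sub t idS ≡ t
  sub-idS t = sub-≈idS t λ _ → refl

  sub-pow-≈idS : ∀ {σ : Subst} → σ ≈ₛ idS → ∀ n t → sub t (pow σ n) ≡ t
  sub-pow-≈idS σ≈id zero    t = sub-idS t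
  sub-pow-≈idS {σ} σ≈id (suc n) t = begin
    sub t (pow σ n ⊙ σ)     ≡⟨ sub-⊙ t (pow σ n) σ ⟩
    sub (sub t (pow σ n)) σ ≡⟨ sub-≈idS (sub t (pow σ n)) σ≈id ⟩
    sub t (pow σ n)         ≡⟨ sub-pow-≈idS σ≈id n t ⟩
    t                       ∎
    where open ≡-Reasoning

  sub-comm : ∀ {σ τ : Subst} → Commutes σ τ → ∀ t → sub (sub t σ) τ ≡ sub (sub t τ) σ
  sub-comm {σ} {τ} comm t = begin
    sub (sub t σ) τ ≡⟨ sub-⊙ t σ τ ⟨
    sub t (σ ⊙ τ)   ≡⟨ sub-cong t comm ⟩
    sub t (τ ⊙ σ)   ≡⟨ sub-⊙ t τ σ ⟩
    sub (sub t τ) σ ∎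
    where open ≡-Reasoning

  sub-pow-comm : ∀ {σ τ : Subst} → Commutes σ τ →
    ∀ n t → sub (sub t (pow σ n)) τ ≡ sub (sub t τ) (pow σ n)
  sub-pow-comm {σ} {τ} comm zero t =
    trans (cong (λ s → sub s τ) (sub-idS t)) (sym (sub-idS (sub t τ)))
  sub-pow-comm {σ} {τ} comm (suc n) t = begin
    sub (sub t (pow σ n ⊙ σ)) τ     ≡⟨ cong (λ s → sub s τ) (sub-⊙ t (pow σ n) σ) ⟩
    sub (sub (sub t (pow σ n)) σ) τ ≡⟨ sub-comm comm (sub t (pow σ n)) ⟩
    sub (sub (sub t (pow σ n)) τ) σ ≡⟨ cong (λ s → sub s σ) (sub-pow-comm comm n t) ⟩
    sub (sub (sub t τ) (pow σ n)) σ ≡⟨ sub-⊙ (sub t τ) (pow σ n) σ ⟨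
    sub (sub t τ) (pow σ n ⊙ σ)     ∎
    where open ≡-Reasoning

  sub-pow-⊙ : ∀ {σ τ : Subst} → Commutes σ τ →
    ∀ n t → sub t (pow (τ ⊙ σ) n) ≡ sub (sub t (pow τ n)) (pow σ n)
  sub-pow-⊙ comm zero t = sym (sub-idS (sub t idS))
  sub-pow-⊙ {σ} {τ} comm (suc n) t = begin
    sub t (pow (τ ⊙ σ) n ⊙ (τ ⊙ σ))
      ≡⟨ sub-⊙ t (pow (τ ⊙ σ) n) (τ ⊙ σ) ⟩
    sub (sub t (pow (τ ⊙ σ) n)) (τ ⊙ σ)
      ≡⟨ sub-⊙ (sub t (pow (τ ⊙ σ) n)) τ σ ⟩
    sub (sub (sub t (pow (τ ⊙ σ) n)) τ) σ
      ≡⟨ cong (λ s → sub (sub s τ) σ) (sub-pow-⊙ comm n t) ⟩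
    sub (sub (sub (sub t (pow τ n)) (pow σ n)) τ) σ
      ≡⟨ cong (λ s → sub s σ) (sub-pow-comm comm n (sub t (pow τ n))) ⟩
    sub (sub (sub (sub t (pow τ n)) τ) (pow σ n)) σ
      ≡⟨ sub-⊙ (sub (sub t (pow τ n)) τ) (pow σ n) σ ⟨
    sub (sub (sub t (pow τ n)) τ) (pow σ n ⊙ σ)
      ≡⟨ cong (λ s → sub s (pow σ n ⊙ σ)) (sub-⊙ t (pow τ n) τ) ⟨
    sub (sub t (pow τ n ⊙ τ)) (pow σ n ⊙ σ)
      ∎
    where open ≡-Reasoning

  sub-atP-⊙ : ∀ {σ μ σᵢ μᵢ : Subst} → Commutes σ σᵢ → Commutes σ μᵢ → ∀ n t →
    sub (sub t (atP (σᵢ , μᵢ) n)) (atP (σ , μ) n) ≡ sub t (atP (σᵢ ⊙ σ , μᵢ ⊙ μ) n)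
  sub-atP-⊙ {σ} {μ} {σᵢ} {μᵢ} commσ commμ n t = begin
    sub (sub t (pow σᵢ n ⊙ μᵢ)) (pow σ n ⊙ μ)
      ≡⟨ sub-⊙ (sub t (pow σᵢ n ⊙ μᵢ)) (pow σ n) μ ⟩
    sub (sub (sub t (pow σᵢ n ⊙ μᵢ)) (pow σ n)) μ
      ≡⟨ cong (λ s → sub (sub s (pow σ n)) μ) (sub-⊙ t (pow σᵢ n) μᵢ) ⟩
    sub (sub (sub (sub t (pow σᵢ n)) μᵢ) (pow σ n)) μ
      ≡⟨ cong (λ s → sub s μ) (sub-pow-comm commμ n (sub t (pow σᵢ n))) ⟨
    sub (sub (sub (sub t (pow σᵢ n)) (pow σ n)) μᵢ) μ
      ≡⟨ cong (λ s → sub (sub s μᵢ) μ) (sub-pow-⊙ commσ n t) ⟨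
    sub (sub (sub t (pow (σᵢ ⊙ σ) n)) μᵢ) μ
      ≡⟨ sub-⊙ (sub t (pow (σᵢ ⊙ σ) n)) μᵢ μ ⟨
    sub (sub t (pow (σᵢ ⊙ σ) n)) (μᵢ ⊙ μ)
      ≡⟨ sub-⊙ t (pow (σᵢ ⊙ σ) n) (μᵢ ⊙ μ) ⟨
    sub t (pow (σᵢ ⊙ σ) n ⊙ (μᵢ ⊙ μ))
      ∎
    where open ≡-Reasoning

  subE-⊙ : ∀ s (σ θ : Subst) → subE s (σ ⊙ θ) ≡ subE (subE s σ) θ
  subE-⊙ e      σ θ = refl
  subE-⊙ (tm t) σ θ = cong tm (sub-⊙ t σ θ)

  subE-idS : ∀ s → subE s idS ≡ s
  subE-idS e      = refl
  subE-idS (tm t) = cong tm (sub-idS t)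

  subE≡e⇒≡e : ∀ (s : TermE Sig) (σ : Subst) → subE s σ ≡ e → s ≡ e
  subE≡e⇒≡e e σ _ = refl

  evalP-≈hat : ∀ (p : PatTerm) {s} n → p ≈ₚ hat s → evalP p n ≡ s
  evalP-≈hat (e    , _)      n (refl , _) = refl
  evalP-≈hat (tm t , (σ , μ)) n (refl , σ≈id , μ≈id) = cong tm (begin
    sub t (pow σ n ⊙ μ)     ≡⟨ sub-⊙ t (pow σ n) μ ⟩
    sub (sub t (pow σ n)) μ ≡⟨ sub-≈idS (sub t (pow σ n)) μ≈id ⟩
    sub t (pow σ n)         ≡⟨ sub-pow-≈idS σ≈id n t ⟩
    t                       ∎)
    where open ≡-Reasoning

  evalP-hat : ∀ s n → evalP (hat s) n ≡ s
  evalP-hat s n = evalP-≈hat (hat s) n (refl , (λ _ → refl) , (λ _ → refl))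

  evalP-⊙ : ∀ s {σ μ σᵢ μᵢ : Subst} → Commutes σ σᵢ → Commutes σ μᵢ → ∀ n →
    subE (evalP (s , (σᵢ , μᵢ)) n) (atP (σ , μ) n) ≡ evalP (s , (σᵢ ⊙ σ , μᵢ ⊙ μ)) n
  evalP-⊙ e      commσ commμ n = refl
  evalP-⊙ (tm t) commσ commμ n = cong tm (sub-atP-⊙ commσ commμ n t)

  IsRenaming-idS : IsRenaming (idS {Sig})
  IsRenaming-idS = (λ x → x) , (λ _ → refl) , (λ _ _ eq → eq) , (λ y → y , refl)

  IsRenaming-⊙ : ∀ {ρ ρ' : Subst {Sig}} → IsRenaming ρ → IsRenaming ρ' → IsRenaming (ρ ⊙ ρ')
  IsRenaming-⊙ {ρ} {ρ'} (f , ρ≗f , f-inj , f-surj) (g , ρ'≗g , g-inj , g-surj) =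
    g ∘ f ,
    (λ x → trans (cong (λ t → sub t ρ') (ρ≗f x)) (ρ'≗g (f x))) ,
    (λ x y eq → f-inj x y (g-inj (f x) (f y) eq)) ,
    λ z → let (y , gy≡z) = g-surj z ; (x , fx≡y) = f-surj y in x , trans (cong g fx≡y) gy≡z

  renB-⊙ : ∀ (b : BinRule) ρ ρ' → renB (renB b ρ) ρ' ≡ renB b (ρ ⊙ ρ')
  renB-⊙ (u , v) ρ ρ' = sym (cong₂ _,_ (sub-⊙ u ρ ρ') (subE-⊙ v ρ ρ'))

  renB-idS : ∀ (b : BinRule) → renB b idS ≡ b
  renB-idS (u , v) = cong₂ _,_ (sub-idS u) (subE-idS v)

  fixes? : ∀ (σ : Subst) y → Dec (app σ y ≡ var y)
  fixes? σ y with app σ y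
  ... | var z    = Dec.map′ (cong var) var-injective (z ≟ y)
    where
    var-injective : ∀ {z y} → var {Sig} z ≡ var y → z ≡ y
    var-injective refl = refl
  ... | fun f ts = no λ ()

  occ-app : ∀ {x} (σ : Subst) y → Occ x (app σ y) → x ≡ y ⊎ VarS σ x
  occ-app σ y occ with fixes? σ y
  ... | yes fixed = inj₁ (subst (Occ _) fixed occ)
  ... | no moved  = inj₂ (inj₂ (y , moved , occ))

  mutual
    occ-sub : ∀ {x} t (σ : Subst) → Occ x (sub t σ) → Occ x t ⊎ VarS σ x
    occ-sub (var y)    σ occ = occ-app σ y occ
    occ-sub (fun f ts) σ occ = occ-subV ts σ occ

    occ-subV : ∀ {x n} (ts : Vec T n) (σ : Subst) → OccV x (subV ts σ) → OccV x ts ⊎ VarS σ x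
    occ-subV (t ∷ ts) σ (inj₁ occ) = Sum.map₁ inj₁ (occ-sub t σ occ)
    occ-subV (t ∷ ts) σ (inj₂ occ) = Sum.map₁ inj₂ (occ-subV ts σ occ)

  occ-sub-pow : ∀ {x} t (σ : Subst) n → Occ x (sub t (pow σ n)) → Occ x t ⊎ VarS σ x
  occ-sub-pow t σ zero    occ = inj₁ (subst (Occ _) (sub-idS t) occ)
  occ-sub-pow t σ (suc n) occ
    with occ-sub (sub t (pow σ n)) σ (subst (Occ _) (sub-⊙ t (pow σ n) σ) occ)
  ... | inj₁ occ'  = occ-sub-pow t σ n occ'
  ... | inj₂ moved = inj₂ moved

  occ-evalP : ∀ {x} (p : PatTerm) n → OccE x (evalP p n) → VarPT p x
  occ-evalP (tm t , (σ , μ)) n occ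
    with occ-sub (sub t (pow σ n)) μ (subst (Occ _) (sub-⊙ t (pow σ n) μ) occ)
  ... | inj₁ occ'  = Sum.map₂ inj₁ (occ-sub-pow t σ n occ')
  ... | inj₂ moved = inj₂ (inj₂ moved)

  VarB⊆VarPR : ∀ {b : BinRule} {R : PatRule} {n} → embB b ≡ ruleAt R n → VarB b ⊆ VarPR R
  VarB⊆VarPR {R = p , q} {n} eq (inj₁ occ) =
    inj₁ (occ-evalP p n (subst (OccE _) (cong proj₁ eq) occ))
  VarB⊆VarPR {R = p , q} {n} eq (inj₂ occ) =
    inj₂ (occ-evalP q n (subst (OccE _) (cong proj₂ eq) occ))

  patBody : ∀ {k} → Vec (PatTerm {Sig}) k → PatRule → Vec PatRule (suc k)
  patBody ps q = Vec.map (λ p → (p , hat e)) ps ∷ʳ q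

  binBody : ∀ {k} → Vec T k → BinRule → Vec BinRule (suc k)
  binBody us b = Vec.map (λ w → (w , e)) us ∷ʳ b

  decompose : ∀ n {k} (ps : Vec (PatTerm {Sig}) k) (q : PatRule) (bs : Vec BinRule (suc k)) →
    (∀ j → embB (lookup bs j) ≡ ruleAt (lookup (patBody ps q) j) n) →
    Σ (Vec T k) λ us → Σ T λ ui → Σ (TermE Sig) λ v →
      (bs ≡ binBody us (ui , v)) ×
      (Vec.map tm (us ∷ʳ ui) ≡ Vec.map (λ p → evalP p n) (ps ∷ʳ proj₁ q)) ×
      (v ≡ evalP (proj₂ q) n)
  decompose n []       q ((u , v) ∷ []) eval =
    [] , u , v , refl , cong (λ b → proj₁ b ∷ []) (eval zero) , cong proj₂ (eval zero)
  decompose n (p ∷ ps) q ((u , v) ∷ bs) eval with decompose n ps q bs (eval ∘ suc)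
  ... | us , ui , v' , bs≡ , terms , v'≡ =
    u ∷ us , ui , v' ,
    cong₂ _∷_ (cong (λ b → u , proj₂ b) (eval zero)) bs≡ ,
    cong₂ _∷_ (cong proj₁ (eval zero)) terms ,
    v'≡

  map-evalP-hat : ∀ n {m} (ws : Vec T m) →
    Vec.map (λ q → evalP q n) (Vec.map (λ w → hat (tm w)) ws) ≡ Vec.map tm ws
  map-evalP-hat n ws =
    trans (sym (VecP.map-∘ _ _ ws)) (VecP.map-cong (λ w → evalP-hat (tm w) n) ws)

  lastRule : ∀ {P U r} → StepP {Sig} P U r → PatRule
  lastRule step = (pᵢ , (v , (σᵢ , μᵢ))) where open StepP step

  module _ (P : Program {Sig}) where

    StepB-mono : ∀ {U V : BinRule → Set} → U ⊆ V → StepB P U ⊆ StepB P V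
    StepB-mono U⊆V step = record
      { u = u ; vs = vs ; inP = inP ; k = k ; pre = pre ; vi = vi ; post = post
      ; split = split ; us = us ; ui = ui ; v = v
      ; seq = (λ j → Sum.map₁ U⊆V (proj₁ seq j)) , proj₂ seq
      ; nonE = nonE ; θ = θ ; mgu = mgu ; res = res }
      where open StepB step

    Tβ-mono : ∀ {U V : BinRule → Set} → U ⊆ V → Tβ P U ⊆ Tβ P V
    Tβ-mono U⊆V (inj₁ fact)            = inj₁ fact
    Tβ-mono U⊆V (inj₂ (r , step , ren)) = inj₂ (r , StepB-mono U⊆V step , ren)

    Tβ^-mono : ∀ {m n} → m ≤ n → Tβ^ P m ⊆ Tβ^ P n
    Tβ^-mono z≤n       ()
    Tβ^-mono (s≤s m≤n) = Tβ-mono (Tβ^-mono m≤n)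

    RenB-ren : ∀ {U : BinRule {Sig} → Set} {b : BinRule} {ρ : Subst} →
      IsRenaming ρ → RenB U b → RenB U (renB b ρ)
    RenB-ren {ρ = ρ} ren (r , r∈U , ρ₀ , ren₀ , refl) =
      r , r∈U , ρ₀ ⊙ ρ , IsRenaming-⊙ {ρ₀} ren₀ ren , renB-⊙ r ρ₀ ρ

    Tβ^-ren : ∀ {N} {b : BinRule} {ρ : Subst} → IsRenaming ρ → Tβ^ P N b → Tβ^ P N (renB b ρ)
    Tβ^-ren {suc N} ren = Sum.map (RenB-ren ren) (RenB-ren ren)

    CorrectRule-InRen : ∀ {r r'} → CorrectRule P r → InRen r r' → CorrectRule P r'
    CorrectRule-InRen correct r⇝r' n with r⇝r' n
    ... | m , ρ , ren , eq with correct m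
    ...   | b , (N , b∈) , b≡ =
      renB b ρ , (N , Tβ^-ren ren b∈) , trans (cong (λ q → renPair q ρ) b≡) (sym eq)

    RenP-correct : ∀ {U : PatRule → Set} → (∀ r → U r → CorrectRule P r) →
      ∀ r → RenP U r → CorrectRule P r
    RenP-correct correct r (r₀ , r₀∈U , r₀⇝r) = CorrectRule-InRen (correct r₀ r₀∈U) r₀⇝r

    record Instance (V : BinRule {Sig} → Set) (n : ℕ) (R : PatRule) (b : BinRule) : Set where
      field
        member : V b ⊎ IdRule b
        eval   : embB b ≡ ruleAt R n

    Seq≪-instances : ∀ {V : BinRule → Set} {W : PatRule → Set} {S : ℕ → Set} {n m}
      (Rs : Vec PatRule m) (bs : Vec BinRule m) →
      (∀ j → Instance V n (lookup Rs j) (lookup bs j)) →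
      Seq≪ {Sig} VarPR S W Rs → Seq≪ {Sig} VarB S (λ b → V b ⊎ IdRule b) bs
    Seq≪-instances {n = n} Rs bs insts (_ , apart , disjoint) =
      Instance.member ∘ insts ,
      (λ j x occ → apart j x (vars j occ)) ,
      (λ j j' j≢j' x occ occ' → disjoint j j' j≢j' x (vars j occ) (vars j' occ'))
      where
      vars : ∀ j → VarB (lookup bs j) ⊆ VarPR (lookup Rs j)
      vars j = VarB⊆VarPR {R = lookup Rs j} {n} (Instance.eval (insts j))

    Instance-mono : ∀ {V W : BinRule → Set} {n R} → V ⊆ W → Instance V n R ⊆ Instance W n R
    Instance-mono V⊆W inst = record { member = Sum.map₁ V⊆W member ; eval = eval }
      where open Instance inst

    module _ {U : PatRule {Sig} → Set} (U-correct : ∀ r → U r → CorrectRule P r) where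

      instance-of : ∀ n R → U R ⊎ PatId R → Σ ℕ λ N → Σ BinRule λ b → Instance (Tβ^ P N) n R b
      instance-of n R (inj₁ R∈U) with U-correct R R∈U n
      ... | b , (N , b∈) , eval = N , b , record { member = inj₁ b∈ ; eval = eval }
      instance-of n (p , q) (inj₂ (f , xs , distinct , p≈ , q≈)) =
        0 , (w , tm w) , record
          { member = inj₂ (f , xs , distinct , refl)
          ; eval   = sym (cong₂ _,_ (evalP-≈hat p n p≈) (evalP-≈hat q n q≈)) }
        where w = fun f (Vec.map var xs)

      instances : ∀ n {m} (Rs : Vec PatRule m) → (∀ j → U (lookup Rs j) ⊎ PatId (lookup Rs j)) →
        Σ ℕ λ N → Σ (Vec BinRule m) λ bs → ∀ j → Instance (Tβ^ P N) n (lookup Rs j) (lookup bs j)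
      instances n []       Rs∈ = 0 , [] , λ ()
      instances n (R ∷ Rs) Rs∈ with instance-of n R (Rs∈ zero) | instances n Rs (Rs∈ ∘ suc)
      ... | N₁ , b , inst | N₂ , bs , insts =
        N₁ ⊔ N₂ , b ∷ bs , λ where
          zero    → Instance-mono (Tβ^-mono (m≤m⊔n N₁ N₂)) inst
          (suc j) → Instance-mono (Tβ^-mono (m≤n⊔m N₁ N₂)) (insts j)

      StepP-correct : ∀ r → StepP P U r → CorrectRule P r
      StepP-correct r step n
        with instances n (patBody (StepP.ps step) (lastRule step)) (proj₁ (StepP.seq step))
      ... | N , bs , insts with decompose n (StepP.ps step) (lastRule step) bs (Instance.eval ∘ insts)
      ... | us , ui , _ , refl , terms , refl =
        b , (suc N , inj₂ (b , b-step , idS , IsRenaming-idS , sym (renB-idS b))) , b-eval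
        where
        open StepP step
        θ : Subst
        θ = atP (σ , μ) n
        vₙ : TermE Sig
        vₙ = evalP (v , (σᵢ , μᵢ)) n
        b : BinRule
        b = (sub u θ , subE vₙ θ)
        b-step : StepB P (Tβ^ P N) b
        b-step = record
          { u = u ; vs = vs ; inP = inP ; k = k ; pre = pre ; vi = vi ; post = post
          ; split = split ; us = us ; ui = ui ; v = vₙ
          ; seq  = Seq≪-instances {W = λ R → U R ⊎ PatId R}
                     (patBody ps (lastRule step)) (binBody us (ui , vₙ)) insts seq
          ; nonE = λ post≢[] vₙ≡e → nonE post≢[] (subE≡e⇒≡e v _ vₙ≡e)
          ; θ    = θ
          ; mgu  = subst₂ (IsMGU θ) (sym terms) (map-evalP-hat n (pre ∷ʳ vi)) (mgu n)
          ; res  = refl }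
        b-eval : embB b ≡ ruleAt r n
        b-eval = subst (λ r → embB b ≡ ruleAt r n) (sym res)
                   (cong (tm (sub u θ) ,_) (evalP-⊙ v commσ commμ n))

    Tπ^-correct : ∀ {B} → Correct P B → ∀ m r → Tπ^ P B m r → CorrectRule P r
    Tπ^-correct B-correct zero    r ()
    Tπ^-correct B-correct (suc m) r =
      [ RenP-correct B-correct r , RenP-correct (StepP-correct (Tπ^-correct B-correct m)) r ]

theorem3p12 : (Sig : Signature) (P : Program {Sig}) (B : PatRule {Sig} → Set) →
    Correct P B → Correct P (patunf P B)
theorem3p12 Sig P B B-correct r (m , r∈) = Tπ^-correct P B-correct m r r∈
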